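{- Let $G=(V,E)$ be a connected simple bridgeless triangle-free cubic graph, let $\lambda$ be a valid labeling of $\mathfrak{L}_2(G)$, and let $\Gamma_\lambda$ be the set of cycles formed by the open edges. Then $\{W(\gamma)\}_{\gamma\in\Gamma_\lambda}$ is a family of closed walks in $G$ such that, counted over all walks in the family with multiplicity, every edge of $G$ is traversed exactly twice.
   Context: Line graph $\mathcal{L}(H)$: vertex set $E(H)$, two edges adjacent iff they share exactly one endpoint. For each triangle $T$ of $\mathcal{L}(G)$ its three edges span a triangle in $\mathcal{L}(\mathcal{L}(G))$; $\mathfrak{L}_2(G)$ is $\mathcal{L}(\mathcal{L}(G))$ with all edges of all these triangles deleted. A vertex of $\mathfrak{L}_2(G)$ is an edge of $\mathcal{L}(G)$, i.e. an unordered pair $\{e,f\}$ of distinct edges of $G$ sharing an endpoint. Reduced cliques: for each $x\in E$, the four edges of $\mathcal{L}(G)$ incident to $x$ form a $K_4$ in $\mathcal{L}(\mathcal{L}(G))$; the reduced clique $\mathbb{X}_x$ is this $K_4$ minus the deleted edges. A labeling $\lambda:E(\mathfrak{L}_2(G))\to\{0,1\}$ (1 = open, 0 = closed) is valid if for every reduced clique $\mathbb{X}$ and every vertex $v$ of $\mathbb{X}$ there are vertices $w,u\neq v$ of $\mathbb{X}$ with $\langle v,w\rangle,\langle v,u\rangle\in E(\mathbb{X})$ and $\lambda_{\langle v,w\rangle}=1-\lambda_{\langle v,u\rangle}$. The open edges of a valid labeling form a disjoint union of cycles; $\Gamma_\lambda$ denotes this set of cycles. Projection to $G$: if $\gamma\in\Gamma_\lambda$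 has cyclic vertex sequence $p_1,\dots,p_k$, consecutive vertices $p_{i-1},p_i$ share exactly one edge $x_i$ of $G$, and $W(\gamma)$ is the closed walk in $G$ with cyclic sequence of traversed edges $x_1,\dots,x_k$. -}

module Defs where

open import Data.Nat using (ℕ; _≤_)
open import Data.Fin using (Fin; _<_; _≟_)
open import Data.Bool using (Bool; true; not; if_then_else_)
open import Data.Product using (Σ; Σ-syntax; _×_; _,_; proj₁; proj₂)
open import Data.Product.Properties using (≡-dec)
open import Data.Sum using (_⊎_)
open import Data.Unit using (⊤)
open import Data.Empty using (⊥)
open import Data.List using (List; []; _∷_; _++_; [_]; zip; map; filter; length; allFin)
open import Data.Nat.ListAction using (sum)
open import Data.List.Relation.Unary.All using (All)
open import Data.List.Relation.Unary.Unique.Propositional using (Unique)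
open import Relation.Nullary using (¬_; Dec; does)
open import Relation.Nullary.Decidable using (_⊎-dec_)
open import Relation.Binary.PropositionalEquality using (_≡_; _≢_)

rotate : {A : Set} → List A → List A
rotate []       = []
rotate (x ∷ xs) = xs ++ [ x ]

cyclicPairs : {A : Set} → List A → List (A × A)
cyclicPairs xs = zip xs (rotate xs)

-- A finite graph: vertex set Fin n, edge set Fin m, each edge e has
-- endpoints src e and tgt e (orientation is irrelevant everywhere below).

record Graph : Set where
  field
    n m : ℕ
    src tgt : Fin m → Fin n

module _ (G : Graph) where
  open Graph G

  Inc : Fin n → Fin m → Set
  Inc v e = src e ≡ v ⊎ tgt e ≡ v

  inc? : (v : Fin n) (e : Fin m) → Dec (Inc v e)
  inc? v e = (src e ≟ v) ⊎-dec (tgt e ≟ v)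

  Joins : Fin m → Fin n → Fin n → Set
  Joins e u w = (src e ≡ u × tgt e ≡ w) ⊎ (src e ≡ w × tgt e ≡ u)

  Adj : Fin n → Fin n → Set
  Adj u w = Σ[ e ∈ Fin m ] Joins e u w

  Simple : Set
  Simple = (∀ e → src e ≢ tgt e) × (∀ e f → Joins f (src e) (tgt e) → e ≡ f)

  degree : Fin n → ℕ
  degree v = length (filter (inc? v) (allFin m))

  Cubic : Set
  Cubic = ∀ v → degree v ≡ 3

  data Path (ok : Fin m → Set) : Fin n → Fin n → Set where
    nil  : ∀ {v} → Path ok v v
    cons : ∀ {u w v} (e : Fin m) → ok e → Joins e u w → Path ok w v → Path ok u v

  Connected : Set
  Connected = ∀ u v → Path (λ _ → ⊤) u v

  Bridgeless : Set
  Bridgeless = ∀ e → Path (λ f → f ≢ e) (src e) (tgt e)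

  TriangleFree : Set
  TriangleFree = ∀ u v w → Adj u v → Adj v w → Adj u w → ⊥

  LAdj : Fin m → Fin m → Set
  LAdj e f = Σ[ v ∈ Fin n ] (Inc v e × Inc v f × (∀ w → Inc w e → Inc w f → w ≡ v))

  -- Vertices of 𝔏₂(G) = edges of L(G) = unordered pairs {a,b} of
  -- L(G)-adjacent edges; represented canonically as (a , b) with a < b.

  Pair : Set
  Pair = Fin m × Fin m

  IsV2 : Pair → Set
  IsV2 (a , b) = a < b × LAdj a b

  _∈₂_ : Fin m → Pair → Set
  x ∈₂ (a , b) = x ≡ a ⊎ x ≡ b

  LLAdj : Pair → Pair → Set
  LLAdj p q = IsV2 p × IsV2 q ×
              Σ[ x ∈ Fin m ] (x ∈₂ p × x ∈₂ q × (∀ y → y ∈₂ p → y ∈₂ q → y ≡ x))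

  PairIs : Pair → Fin m → Fin m → Set
  PairIs (c , d) a b = (c ≡ a × d ≡ b) ⊎ (c ≡ b × d ≡ a)

  EdgeOfTri : Pair → Fin m → Fin m → Fin m → Set
  EdgeOfTri p x y z = PairIs p x y ⊎ PairIs p y z ⊎ PairIs p x z

  Deleted : Pair → Pair → Set
  Deleted p q = Σ[ x ∈ Fin m ] Σ[ y ∈ Fin m ] Σ[ z ∈ Fin m ]
                (LAdj x y × LAdj y z × LAdj x z × EdgeOfTri p x y z × EdgeOfTri q x y z)

  E2Adj : Pair → Pair → Set
  E2Adj p q = LLAdj p q × ¬ Deleted p q

  InClique : Fin m → Pair → Set
  InClique x p = IsV2 p × x ∈₂ p

  -- A labeling of the (unordered) edges of 𝔏₂(G) is encoded
  -- as a function on ordered pairs, required to be symmetric on edges;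
  -- values on non-edges are irrelevant.  true = open, false = closed.

  Labeling : Set
  Labeling = Pair → Pair → Bool

  SymmetricLabeling : Labeling → Set
  SymmetricLabeling λ' = ∀ p q → E2Adj p q → λ' p q ≡ λ' q p

  Valid : Labeling → Set
  Valid λ' = ∀ x v → InClique x v →
    Σ[ w ∈ Pair ] Σ[ u ∈ Pair ]
      (InClique x w × InClique x u × w ≢ v × u ≢ v ×
       E2Adj v w × E2Adj v u × λ' v w ≡ not (λ' v u))

  Open : Labeling → Pair → Pair → Set
  Open λ' p q = E2Adj p q × λ' p q ≡ true

  -- γ = cyclic vertex sequence p1,…,pk of a cycle formed by open edges
  IsOpenCycle : Labeling → List Pair → Set
  IsOpenCycle λ' γ = 3 ≤ length γ × Unique γ ×
                     All (λ pq → Open λ' (proj₁ pq) (proj₂ pq)) (cyclicPairs γ)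

  pair? : (p q : Pair) → Dec (p ≡ q)
  pair? = ≡-dec _≟_ _≟_

  occurrences : Pair → Pair → List Pair → ℕ
  occurrences p q γ =
    length (filter (λ ab → pp? ab (p , q) ⊎-dec pp? ab (q , p)) (cyclicPairs γ))
    where pp? = ≡-dec pair? pair?

  -- Γ is the set Γ_λ of cycles formed by the open edges: a list of open
  -- cycles in which every open edge occurs exactly once in total.
  IsCycleSet : Labeling → List (List Pair) → Set
  IsCycleSet λ' Γ = All (IsOpenCycle λ') Γ ×
                    (∀ p q → Open λ' p q → sum (map (occurrences p q) Γ) ≡ 1)

  -- the common element of two pairs sharing exactly one element
  shared : Pair → Pair → Fin m
  shared (a , b) (c , d) = if does ((a ≟ c) ⊎-dec (a ≟ d)) then a else b

  W : List Pair → List (Fin m)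
  W γ = map (λ pq → shared (proj₁ pq) (proj₂ pq)) (cyclicPairs γ)

  -- a cyclic edge sequence x1,…,xk is a closed walk: there are vertices
  -- v0,…,v(k-1) such that xi joins v(i-1) and vi (indices mod k)
  ClosedWalk : List (Fin m) → Set
  ClosedWalk xs = Σ[ vs ∈ List (Fin n) ]
    (length vs ≡ length xs ×
     All (λ x-uv → Joins (proj₁ x-uv) (proj₁ (proj₂ x-uv)) (proj₂ (proj₂ x-uv)))
         (zip xs (cyclicPairs vs)))

  traversals : Fin m → List (Fin m) → ℕ
  traversals e xs = length (filter (λ x → x ≟ e) xs)

{-# OPTIONS --safe #-}
module Submission where

-- Every vertex {a,b} of 𝔏₂(G) has a center, the common endpoint of a and b. Two
-- adjacent vertices p, q of 𝔏₂(G) have distinct centers, since otherwise p and q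
-- would lie in a triangle of L(G) and their edge would have been deleted; hence the
-- edge shared by p and q joins their centers, and W(γ) is the closed walk through
-- the centers of γ. In a simple cubic graph the reduced clique 𝕏_e of an edge e is
-- a 4-cycle and validity makes its labels alternate, so exactly two disjoint edges
-- of 𝕏_e are open. The traversals of e by the walks W(γ) are exactly the steps of
-- the cycles along these two open edges, and each open edge occurs once in Γ_λ.

open import Defs
open import Data.Fin using (Fin; _≟_)
open import Data.Fin.Properties using (<-irrefl; <-asym; <-cmp)
open import Data.Nat using (ℕ; suc; _+_; _⊓_)
open import Data.Nat.Properties using (+-suc; +-comm; ⊓-idem; +-commutativeSemigroup)
open import Algebra.Properties.CommutativeSemigroup +-commutativeSemigroup using (interchange)
open import Data.Bool using (Bool; true; false; not; if_then_else_)
open import Data.Bool.Properties using (not-involutive; not-¬)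
open import Data.Product using (Σ-syntax; _×_; _,_; proj₁; proj₂; <_,_>)
import Data.Product as Product
open import Data.Product.Properties using (≡-dec)
import Data.Sum as Sum
open import Data.Sum using (_⊎_; inj₁; inj₂; [_,_]′; swap; map₁; map₂)
open import Data.Empty using (⊥-elim)
open import Data.List using (List; []; _∷_; _++_; [_]; zip; map; filter; length; allFin)
open import Data.Nat.ListAction using (sum)
open import Data.List.Properties using (length-++; map-++; length-map; length-zipWith; zip-map; map-cong-local)
open import Data.List.Membership.Propositional using (_∈_)
open import Data.List.Membership.Propositional.Properties using (∈-filter⁺; ∈-filter⁻; ∈-allFin)
open import Data.List.Relation.Unary.Any using (here; there)
open import Data.List.Relation.Unary.All using (All; []; _∷_)
import Data.List.Relation.Unary.All as All
import Data.List.Relation.Unary.All.Properties as All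
open import Data.List.Relation.Unary.AllPairs using ([]; _∷_)
open import Data.List.Relation.Unary.Unique.Propositional using (Unique)
import Data.List.Relation.Unary.Unique.Propositional.Properties as Unique
open import Relation.Nullary using (¬_; Dec; yes; no; does)
open import Relation.Nullary.Decidable using (_⊎-dec_)
open import Relation.Unary using (Decidable)
open import Relation.Binary.PropositionalEquality
  using (_≡_; _≢_; refl; sym; trans; cong; cong₂; subst; ≢-sym; module ≡-Reasoning)
open import Function using (_∘_)
open import Relation.Binary.Definitions using (tri<; tri≈; tri>)

module _ {A : Set} where

  length-rotate : (xs : List A) → length (rotate xs) ≡ length xs
  length-rotate []       = refl
  length-rotate (x ∷ xs) = trans (length-++ xs) (+-comm (length xs) 1)

  length-cyclicPairs : (xs : List A) → length (cyclicPairs xs) ≡ length xs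
  length-cyclicPairs xs = begin
    length (zip xs (rotate xs))     ≡⟨ length-zipWith _,_ xs (rotate xs) ⟩
    length xs ⊓ length (rotate xs)  ≡⟨ cong (length xs ⊓_) (length-rotate xs) ⟩
    length xs ⊓ length xs           ≡⟨ ⊓-idem (length xs) ⟩
    length xs                       ∎
    where open ≡-Reasoning

  cyclicPairs-map : {B : Set} (f : A → B) (xs : List A) →
                    cyclicPairs (map f xs) ≡ map (Product.map f f) (cyclicPairs xs)
  cyclicPairs-map f []       = refl
  cyclicPairs-map f (x ∷ xs) = begin
    zip (f x ∷ map f xs) (map f xs ++ [ f x ])   ≡⟨ cong (zip (map f (x ∷ xs))) (sym (map-++ f xs [ x ])) ⟩
    zip (map f (x ∷ xs)) (map f (xs ++ [ x ]))   ≡⟨ zip-map f f (x ∷ xs) (xs ++ [ x ]) ⟩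
    map (Product.map f f) (cyclicPairs (x ∷ xs)) ∎
    where open ≡-Reasoning

  zip-map-map : {B C : Set} (f : A → B) (g : A → C) (xs : List A) →
                zip (map f xs) (map g xs) ≡ map < f , g > xs
  zip-map-map f g []       = refl
  zip-map-map f g (x ∷ xs) = cong ((f x , g x) ∷_) (zip-map-map f g xs)

  filter-map : {B : Set} {P : B → Set} (P? : Decidable P) (f : A → B) (xs : List A) →
               filter P? (map f xs) ≡ map f (filter (λ x → P? (f x)) xs)
  filter-map P? f []       = refl
  filter-map P? f (x ∷ xs) with does (P? (f x))
  ... | true  = cong (f x ∷_) (filter-map P? f xs)
  ... | false = filter-map P? f xs

  sum-map-+ : (f g : A → ℕ) (xs : List A) →
              sum (map (λ x → f x + g x) xs) ≡ sum (map f xs) + sum (map g xs)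
  sum-map-+ f g []       = refl
  sum-map-+ f g (x ∷ xs) = trans (cong (f x + g x +_) (sum-map-+ f g xs))
                                 (interchange (f x) (g x) (sum (map f xs)) (sum (map g xs)))

module _ {A : Set} {P Q R : A → Set} (P? : Decidable P) (Q? : Decidable Q) (R? : Decidable R)
         (Q⇒P : ∀ {x} → Q x → P x) (R⇒P : ∀ {x} → R x → P x) (Q⇒¬R : ∀ {x} → Q x → ¬ R x) where

  length-filter-⊎ : (xs : List A) → All (λ x → P x → Q x ⊎ R x) xs →
                    length (filter P? xs) ≡ length (filter Q? xs) + length (filter R? xs)
  length-filter-⊎ []       []             = refl
  length-filter-⊎ (x ∷ xs) (P⇒Q⊎R ∷ rest) with ih ← length-filter-⊎ xs rest | P? x | Q? x | R? x
  ... | yes _  | yes q | yes r = ⊥-elim (Q⇒¬R q r)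
  ... | yes _  | yes _ | no _  = cong suc ih
  ... | yes _  | no _  | yes _ = trans (cong suc ih) (sym (+-suc _ _))
  ... | yes p  | no ¬q | no ¬r = ⊥-elim ([ ¬q , ¬r ]′ (P⇒Q⊎R p))
  ... | no ¬p  | yes q | _     = ⊥-elim (¬p (Q⇒P q))
  ... | no ¬p  | no _  | yes r = ⊥-elim (¬p (R⇒P r))
  ... | no _   | no _  | no _  = ih

not-flip : ∀ {b c : Bool} → b ≡ not c → c ≡ not b
not-flip {b} {c} b≡¬c = sym (trans (cong not b≡¬c) (not-involutive c))

record TwoOthers {A : Set} (P : A → Set) (f : A) : Set where
  field
    a b   : A
    a≢f   : a ≢ f
    b≢f   : b ≢ f
    a≢b   : a ≢ b
    P[a]  : P a
    P[b]  : P b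
    cover : ∀ g → P g → g ≡ f ⊎ g ≡ a ⊎ g ≡ b

TwoOthers-map : {A : Set} {P Q : A → Set} {f : A} →
                (∀ {g} → P g → Q g) → (∀ {g} → Q g → P g) → TwoOthers P f → TwoOthers Q f
TwoOthers-map P⇒Q Q⇒P o = record
  { a = a ; b = b ; a≢f = a≢f ; b≢f = b≢f ; a≢b = a≢b ; P[a] = P⇒Q P[a] ; P[b] = P⇒Q P[b]
  ; cover = λ g Q[g] → cover g (Q⇒P Q[g]) }
  where open TwoOthers o

∈-three : {A : Set} {x y z g : A} → g ∈ x ∷ y ∷ z ∷ [] → g ≡ x ⊎ g ≡ y ⊎ g ≡ z
∈-three (here g≡x)                 = inj₁ g≡x
∈-three (there (here g≡y))         = inj₂ (inj₁ g≡y)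
∈-three (there (there (here g≡z))) = inj₂ (inj₂ g≡z)

unique-length3⇒TwoOthers : {A : Set} {xs : List A} {f : A} →
                           Unique xs → length xs ≡ 3 → f ∈ xs → TwoOthers (_∈ xs) f
unique-length3⇒TwoOthers {xs = x ∷ y ∷ z ∷ []} ((x≢y ∷ x≢z ∷ []) ∷ (y≢z ∷ []) ∷ [] ∷ []) refl
  (here refl) = record
  { a = y ; b = z ; a≢f = ≢-sym x≢y ; b≢f = ≢-sym x≢z ; a≢b = y≢z
  ; P[a] = there (here refl) ; P[b] = there (there (here refl))
  ; cover = λ _ g∈ → ∈-three g∈ }
unique-length3⇒TwoOthers {xs = x ∷ y ∷ z ∷ []} ((x≢y ∷ x≢z ∷ []) ∷ (y≢z ∷ []) ∷ [] ∷ []) refl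
  (there (here refl)) = record
  { a = x ; b = z ; a≢f = x≢y ; b≢f = ≢-sym y≢z ; a≢b = x≢z
  ; P[a] = here refl ; P[b] = there (there (here refl))
  ; cover = λ _ g∈ → [ inj₂ ∘ inj₁ , [ inj₁ , inj₂ ∘ inj₂ ]′ ]′ (∈-three g∈) }
unique-length3⇒TwoOthers {xs = x ∷ y ∷ z ∷ []} ((x≢y ∷ x≢z ∷ []) ∷ (y≢z ∷ []) ∷ [] ∷ []) refl
  (there (there (here refl))) = record
  { a = x ; b = y ; a≢f = x≢z ; b≢f = y≢z ; a≢b = x≢y
  ; P[a] = here refl ; P[b] = there (here refl)
  ; cover = λ _ g∈ → [ inj₂ ∘ inj₁ , [ inj₂ ∘ inj₂ , inj₁ ]′ ]′ (∈-three g∈) }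

module _ (G : Graph) where
  open Graph G

  Joins-sym : ∀ {g u w} → Joins G g u w → Joins G g w u
  Joins-sym (inj₁ ends) = inj₂ ends
  Joins-sym (inj₂ ends) = inj₁ ends

  Joins-ends : ∀ {f g u w} → Joins G f u w → Joins G g u w → Joins G g (src f) (tgt f)
  Joins-ends (inj₁ (refl , refl)) g-uw = g-uw
  Joins-ends (inj₂ (refl , refl)) g-uw = Joins-sym g-uw

  Inc⇒Joins : ∀ {g u w} → u ≢ w → Inc G u g → Inc G w g → Joins G g u w
  Inc⇒Joins u≢w (inj₁ refl) (inj₁ refl) = ⊥-elim (u≢w refl)
  Inc⇒Joins u≢w (inj₁ su)   (inj₂ tw)   = inj₁ (su , tw)
  Inc⇒Joins u≢w (inj₂ tu)   (inj₁ sw)   = inj₂ (sw , tu)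
  Inc⇒Joins u≢w (inj₂ refl) (inj₂ refl) = ⊥-elim (u≢w refl)

  degree≡3⇒TwoOthers : ∀ {v f} → degree G v ≡ 3 → Inc G v f → TwoOthers (Inc G v) f
  degree≡3⇒TwoOthers {v} deg v∈f =
    TwoOthers-map incident-edge (∈-filter⁺ (inc? G v) (∈-allFin _))
      (unique-length3⇒TwoOthers (Unique.filter⁺ (inc? G v) (Unique.allFin⁺ m)) deg
        (∈-filter⁺ (inc? G v) (∈-allFin _) v∈f))
    where
    incident-edge : ∀ {g} → g ∈ filter (inc? G v) (allFin m) → Inc G v g
    incident-edge g∈ = proj₂ (∈-filter⁻ (inc? G v) {xs = allFin m} g∈)

  LAdj-sym : ∀ {f g} → LAdj G f g → LAdj G g f
  LAdj-sym (v , v∈f , v∈g , only-v) = v , v∈g , v∈f , λ w w∈g w∈f → only-v w w∈f w∈g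

  PairIs-sym : ∀ {p x y} → PairIs G p x y → PairIs G p y x
  PairIs-sym (inj₁ ends) = inj₂ ends
  PairIs-sym (inj₂ ends) = inj₁ ends

  PairIs-∈₂ : ∀ {p x y} → PairIs G p x y → _∈₂_ G x p
  PairIs-∈₂ (inj₁ (refl , _)) = inj₁ refl
  PairIs-∈₂ (inj₂ (_ , refl)) = inj₂ refl

  PairIs-injʳ : ∀ {p x y z} → PairIs G p x y → PairIs G p x z → y ≡ z
  PairIs-injʳ (inj₁ (refl , refl)) (inj₁ (refl , refl)) = refl
  PairIs-injʳ (inj₁ (refl , refl)) (inj₂ (refl , refl)) = refl
  PairIs-injʳ (inj₂ (refl , refl)) (inj₁ (refl , refl)) = refl
  PairIs-injʳ (inj₂ (refl , refl)) (inj₂ (refl , refl)) = refl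

  IsV2-unique : ∀ {p q x y} → IsV2 G p → IsV2 G q → PairIs G p x y → PairIs G q x y → p ≡ q
  IsV2-unique _          _          (inj₁ (refl , refl)) (inj₁ (refl , refl)) = refl
  IsV2-unique (a<b , _)  (c<d , _)  (inj₁ (refl , refl)) (inj₂ (refl , refl)) = ⊥-elim (<-asym a<b c<d)
  IsV2-unique (a<b , _)  (c<d , _)  (inj₂ (refl , refl)) (inj₁ (refl , refl)) = ⊥-elim (<-asym a<b c<d)
  IsV2-unique _          _          (inj₂ (refl , refl)) (inj₂ (refl , refl)) = refl

  IsV2-pair : ∀ {f g} → f ≢ g → LAdj G f g → Σ[ p ∈ Pair G ] IsV2 G p × PairIs G p f g
  IsV2-pair {f} {g} f≢g f~g with <-cmp f g
  ... | tri< f<g _ _ = (f , g) , (f<g , f~g) , inj₁ (refl , refl)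
  ... | tri≈ _ f≡g _ = ⊥-elim (f≢g f≡g)
  ... | tri> _ _ g<f = (g , f) , (g<f , LAdj-sym f~g) , inj₂ (refl , refl)

  partner : ∀ {p x} → IsV2 G p → _∈₂_ G x p → Σ[ y ∈ Fin m ] PairIs G p x y × LAdj G x y × x ≢ y
  partner {a , b} (a<b , a~b) (inj₁ refl) =
    b , inj₁ (refl , refl) , a~b , λ { refl → <-irrefl refl a<b }
  partner {a , b} (a<b , a~b) (inj₂ refl) =
    a , inj₂ (refl , refl) , LAdj-sym a~b , λ { refl → <-irrefl refl a<b }

  center : Pair G → Fin n
  center (a , b) = if does (inc? G (src a) b) then src a else tgt a

  center-Inc : ∀ {p} → IsV2 G p → Inc G (center p) (proj₁ p) × Inc G (center p) (proj₂ p)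
  center-Inc {a , b} (_ , v , v∈a , v∈b , _) = by-cases (inc? G (src a) b) v∈a
    where
    by-cases : (src∈b? : Dec (Inc G (src a) b)) → Inc G v a →
               let c = if does src∈b? then src a else tgt a in Inc G c a × Inc G c b
    by-cases (yes src∈b) _           = inj₁ refl , src∈b
    by-cases (no  src∉b) (inj₁ refl) = ⊥-elim (src∉b v∈b)
    by-cases (no  _)     (inj₂ refl) = inj₂ refl , v∈b

  center-∈₂ : ∀ {p x} → IsV2 G p → _∈₂_ G x p → Inc G (center p) x
  center-∈₂ {a , b} p-ok (inj₁ refl) = proj₁ (center-Inc p-ok)
  center-∈₂ {a , b} p-ok (inj₂ refl) = proj₂ (center-Inc p-ok)

  shared-unique : ∀ {p q y} → LLAdj G p q → _∈₂_ G y p → _∈₂_ G y q → shared G p q ≡ y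
  shared-unique {a , b} {c , d} {y} (_ , _ , x , _ , _ , only-x) y∈p y∈q =
    by-cases ((a ≟ c) ⊎-dec (a ≟ d)) y∈p
    where
    by-cases : (a∈q? : Dec (_∈₂_ G a (c , d))) → _∈₂_ G y (a , b) → (if does a∈q? then a else b) ≡ y
    by-cases (yes a∈q) _           = trans (only-x a (inj₁ refl) a∈q) (sym (only-x y y∈p y∈q))
    by-cases (no  a∉q) (inj₁ refl) = ⊥-elim (a∉q y∈q)
    by-cases (no  _)   (inj₂ refl) = refl

  shared-∈₂ : ∀ {p q} → LLAdj G p q → _∈₂_ G (shared G p q) p × _∈₂_ G (shared G p q) q
  shared-∈₂ {p} {q} p~q@(_ , _ , x , x∈p , x∈q , _) =
    subst (λ z → _∈₂_ G z p × _∈₂_ G z q) (sym (shared-unique p~q x∈p x∈q)) (x∈p , x∈q)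

  sharedEdge : Pair G × Pair G → Fin m
  sharedEdge (p , q) = shared G p q

  LLAdj-irrefl : ∀ {p} → ¬ LLAdj G p p
  LLAdj-irrefl {a , b} ((a<b , _) , _ , x , _ , _ , only-x) =
    <-irrefl (trans (only-x a (inj₁ refl) (inj₁ refl)) (sym (only-x b (inj₂ refl) (inj₂ refl)))) a<b

  E2Adj-sym : ∀ {p q} → E2Adj G p q → E2Adj G q p
  E2Adj-sym ((p-ok , q-ok , x , x∈p , x∈q , only-x) , ¬deleted) =
    (q-ok , p-ok , x , x∈q , x∈p , λ y y∈q y∈p → only-x y y∈p y∈q) ,
    λ { (x , y , z , x~y , y~z , x~z , q-tri , p-tri) →
          ¬deleted (x , y , z , x~y , y~z , x~z , p-tri , q-tri) }

  E2Adj-irrefl : ∀ {p} → ¬ E2Adj G p p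
  E2Adj-irrefl (p~p , _) = LLAdj-irrefl p~p

  -- The shape of 𝕏_x in a cubic graph: A, B pair x with the other two edges at one
  -- endpoint, C, D with those at the other; AB and CD lie in triangles of L(G) and
  -- are deleted, leaving the 4-cycle A C B D.
  record Square (x : Fin m) : Set where
    field
      A B C D : Pair G
      A∈      : InClique G x A
      B∈      : InClique G x B
      C∈      : InClique G x C
      D∈      : InClique G x D
      A≢B     : A ≢ B
      C≢D     : C ≢ D
      A≁B     : ¬ E2Adj G A B
      C≁D     : ¬ E2Adj G C D
      cover   : ∀ w → InClique G x w → (w ≡ A ⊎ w ≡ B) ⊎ (w ≡ C ⊎ w ≡ D)

  Square-swapAB : ∀ {x} → Square x → Square x
  Square-swapAB sq = record
    { A = B ; B = A ; C = C ; D = D ; A∈ = B∈ ; B∈ = A∈ ; C∈ = C∈ ; D∈ = D∈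
    ; A≢B = ≢-sym A≢B ; C≢D = C≢D ; A≁B = A≁B ∘ E2Adj-sym ; C≁D = C≁D
    ; cover = λ w w∈ → map₁ swap (cover w w∈) }
    where open Square sq

  Square-swapCD : ∀ {x} → Square x → Square x
  Square-swapCD sq = record
    { A = A ; B = B ; C = D ; D = C ; A∈ = A∈ ; B∈ = B∈ ; C∈ = D∈ ; D∈ = C∈
    ; A≢B = A≢B ; C≢D = ≢-sym C≢D ; A≁B = A≁B ; C≁D = C≁D ∘ E2Adj-sym
    ; cover = λ w w∈ → map₂ swap (cover w w∈) }
    where open Square sq

  Square-swapSides : ∀ {x} → Square x → Square x
  Square-swapSides sq = record
    { A = C ; B = D ; C = A ; D = B ; A∈ = C∈ ; B∈ = D∈ ; C∈ = A∈ ; D∈ = B∈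
    ; A≢B = C≢D ; C≢D = A≢B ; A≁B = C≁D ; C≁D = A≁B
    ; cover = λ w w∈ → swap (cover w w∈) }
    where open Square sq

  Square-neighbours-A : ∀ {x} (sq : Square x) → let open Square sq in
                        ∀ w → InClique G x w → w ≢ A → E2Adj G A w → w ≡ C ⊎ w ≡ D
  Square-neighbours-A sq w w∈ w≢A A~w with Square.cover sq w w∈
  ... | inj₁ (inj₁ w≡A) = ⊥-elim (w≢A w≡A)
  ... | inj₁ (inj₂ refl) = ⊥-elim (Square.A≁B sq A~w)
  ... | inj₂ w∈CD       = w∈CD

  module _ (simple : Simple G) where

    edge-unique : ∀ {u w f g} → u ≢ w → Inc G u f → Inc G w f → Inc G u g → Inc G w g → f ≡ g
    edge-unique u≢w u∈f w∈f u∈g w∈g =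
      proj₂ simple _ _ (Joins-ends (Inc⇒Joins u≢w u∈f w∈f) (Inc⇒Joins u≢w u∈g w∈g))

    LAdj-at : ∀ {v f g} → f ≢ g → Inc G v f → Inc G v g → LAdj G f g
    LAdj-at {v} f≢g v∈f v∈g = v , v∈f , v∈g , only-v
      where
      only-v : ∀ w → Inc G w _ → Inc G w _ → w ≡ v
      only-v w w∈f w∈g with w ≟ v
      ... | yes w≡v = w≡v
      ... | no  w≢v = ⊥-elim (f≢g (edge-unique w≢v w∈f v∈f w∈g v∈g))

    E2Adj⇒Joins : ∀ {p q} → E2Adj G p q → Joins G (shared G p q) (center p) (center q)
    E2Adj⇒Joins {p} {q} (p~q@(p-ok , q-ok , x , x∈p , x∈q , only-x) , ¬deleted)
      with partner p-ok x∈p | partner q-ok x∈q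
    ... | y , p≐xy , x~y , x≢y | z , q≐xz , x~z , _ =
      subst (λ s → Joins G s (center p) (center q)) (sym (shared-unique p~q x∈p x∈q))
        (Inc⇒Joins centers-differ (center-∈₂ p-ok x∈p) (center-∈₂ q-ok x∈q))
      where
      y∈p = PairIs-∈₂ (PairIs-sym p≐xy)
      z∈q = PairIs-∈₂ (PairIs-sym q≐xz)

      y≢z : y ≢ z
      y≢z refl = x≢y (sym (only-x y y∈p z∈q))

      centers-differ : center p ≢ center q
      centers-differ cp≡cq = ¬deleted
        ( x , y , z , x~y
        , LAdj-at y≢z (center-∈₂ p-ok y∈p) (subst (λ c → Inc G c z) (sym cp≡cq) (center-∈₂ q-ok z∈q))
        , x~z , inj₁ p≐xy , inj₂ (inj₂ q≐xz))

    W-closedWalk : (γ : List (Pair G)) → All (λ pq → E2Adj G (proj₁ pq) (proj₂ pq)) (cyclicPairs γ) →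
                   ClosedWalk G (W G γ)
    W-closedWalk γ adjacent = map center γ , same-length , steps-join
      where
      same-length : length (map center γ) ≡ length (W G γ)
      same-length = begin
        length (map center γ)   ≡⟨ length-map center γ ⟩
        length γ                ≡⟨ length-cyclicPairs γ ⟨
        length (cyclicPairs γ)  ≡⟨ length-map sharedEdge (cyclicPairs γ) ⟨
        length (W G γ)          ∎
        where open ≡-Reasoning

      JoinsStep : Fin m × (Fin n × Fin n) → Set
      JoinsStep (x , u , w) = Joins G x u w

      steps-join : All JoinsStep (zip (W G γ) (cyclicPairs (map center γ)))
      steps-join = subst (All JoinsStep) (sym (trans (cong (zip (W G γ)) (cyclicPairs-map center γ))
                                                     (zip-map-map sharedEdge _ (cyclicPairs γ))))
                     (All.map⁺ (All.map (λ {pq} → E2Adj⇒Joins {proj₁ pq} {proj₂ pq}) adjacent))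

    record CliqueHalf (x : Fin m) (v : Fin n) : Set where
      field
        P Q   : Pair G
        P∈    : InClique G x P
        Q∈    : InClique G x Q
        P≢Q   : P ≢ Q
        P≁Q   : ¬ E2Adj G P Q
        cover : ∀ {w y} → IsV2 G w → PairIs G w x y → y ≢ x → Inc G v y → w ≡ P ⊎ w ≡ Q

    cliqueHalf : ∀ {x v} → Inc G v x → TwoOthers (Inc G v) x → CliqueHalf x v
    cliqueHalf {x} {v} v∈x others =
      let (P , P-ok , P≐xa) = IsV2-pair (≢-sym a≢f) x~a
          (Q , Q-ok , Q≐xb) = IsV2-pair (≢-sym b≢f) x~b
      in record
        { P = P ; Q = Q ; P∈ = P-ok , PairIs-∈₂ P≐xa ; Q∈ = Q-ok , PairIs-∈₂ Q≐xb
        ; P≢Q = λ P≡Q → a≢b (PairIs-injʳ P≐xa (subst (λ r → PairIs G r x b) (sym P≡Q) Q≐xb))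
        ; P≁Q = λ (_ , ¬deleted) →
            ¬deleted (x , a , b , x~a , LAdj-at a≢b P[a] P[b] , x~b , inj₁ P≐xa , inj₂ (inj₂ Q≐xb))
        ; cover = λ {w} {y} w-ok w≐xy y≢x v∈y →
            [ ⊥-elim ∘ y≢x
            , Sum.map (λ { refl → IsV2-unique w-ok P-ok w≐xy P≐xa })
                      (λ { refl → IsV2-unique w-ok Q-ok w≐xy Q≐xb }) ]′ (cover y v∈y)
        }
      where
      open TwoOthers others
      x~a = LAdj-at (≢-sym a≢f) v∈x P[a]
      x~b = LAdj-at (≢-sym b≢f) v∈x P[b]

    reducedClique-square : Cubic G → ∀ x → Square x
    reducedClique-square cubic x = record
      { A = S.P ; B = S.Q ; C = T.P ; D = T.Q ; A∈ = S.P∈ ; B∈ = S.Q∈ ; C∈ = T.P∈ ; D∈ = T.Q∈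
      ; A≢B = S.P≢Q ; C≢D = T.P≢Q ; A≁B = S.P≁Q ; C≁D = T.P≁Q
      ; cover = cover }
      where
      module S = CliqueHalf (cliqueHalf (inj₁ refl) (degree≡3⇒TwoOthers (cubic (src x)) (inj₁ refl)))
      module T = CliqueHalf (cliqueHalf (inj₂ refl) (degree≡3⇒TwoOthers (cubic (tgt x)) (inj₂ refl)))

      cover : ∀ w → InClique G x w → (w ≡ S.P ⊎ w ≡ S.Q) ⊎ (w ≡ T.P ⊎ w ≡ T.Q)
      cover w (w-ok , x∈w) with partner w-ok x∈w
      ... | y , w≐xy , (_ , inj₁ refl , v∈y , _) , x≢y = inj₁ (S.cover w-ok w≐xy (≢-sym x≢y) v∈y)
      ... | y , w≐xy , (_ , inj₂ refl , v∈y , _) , x≢y = inj₂ (T.cover w-ok w≐xy (≢-sym x≢y) v∈y)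

  Traverses : Pair G → Pair G → Pair G × Pair G → Set
  Traverses p q pq = pq ≡ (p , q) ⊎ pq ≡ (q , p)

  record OpenMatching (λ' : Labeling G) (x : Fin m) : Set where
    field
      P₁ Q₁ P₂ Q₂ : Pair G
      P₁∈    : InClique G x P₁
      Q₁∈    : InClique G x Q₁
      P₂∈    : InClique G x P₂
      Q₂∈    : InClique G x Q₂
      open₁  : Open G λ' P₁ Q₁
      open₂  : Open G λ' P₂ Q₂
      P₁≢P₂  : P₁ ≢ P₂
      P₁≢Q₂  : P₁ ≢ Q₂
      Q₁≢P₂  : Q₁ ≢ P₂
      Q₁≢Q₂  : Q₁ ≢ Q₂
      only   : ∀ p q → Open G λ' p q → InClique G x p → InClique G x q →
               Traverses P₁ Q₁ (p , q) ⊎ Traverses P₂ Q₂ (p , q)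

  traverses? : ∀ p q → Decidable (Traverses p q)
  traverses? p q pq = ≡-dec (pair? G) (pair? G) pq (p , q) ⊎-dec ≡-dec (pair? G) (pair? G) pq (q , p)

  E2Adj-shared : ∀ {x p q} → E2Adj G p q → InClique G x p → InClique G x q → shared G p q ≡ x
  E2Adj-shared (p~q , _) (_ , x∈p) (_ , x∈q) = shared-unique p~q x∈p x∈q

  module _ {λ' : Labeling G} {x : Fin m} (M : OpenMatching λ' x) where
    open OpenMatching M

    Traverses-shared : ∀ {p q pq} → Open G λ' p q → InClique G x p → InClique G x q →
                       Traverses p q pq → sharedEdge pq ≡ x
    Traverses-shared (p~q , _) p∈ q∈ (inj₁ refl) = E2Adj-shared p~q p∈ q∈
    Traverses-shared (p~q , _) p∈ q∈ (inj₂ refl) = E2Adj-shared (E2Adj-sym p~q) q∈ p∈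

    Traverses-disjoint : ∀ {pq} → Traverses P₁ Q₁ pq → ¬ Traverses P₂ Q₂ pq
    Traverses-disjoint (inj₁ refl) (inj₁ eq) = P₁≢P₂ (cong proj₁ eq)
    Traverses-disjoint (inj₁ refl) (inj₂ eq) = P₁≢Q₂ (cong proj₁ eq)
    Traverses-disjoint (inj₂ refl) (inj₁ eq) = Q₁≢P₂ (cong proj₁ eq)
    Traverses-disjoint (inj₂ refl) (inj₂ eq) = Q₁≢Q₂ (cong proj₁ eq)

    open-step-through-x : ∀ {pq} → Open G λ' (proj₁ pq) (proj₂ pq) → sharedEdge pq ≡ x →
                          Traverses P₁ Q₁ pq ⊎ Traverses P₂ Q₂ pq
    open-step-through-x {p , q} pq-open@((p~q@(p-ok , q-ok , _) , _) , _) refl =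
      only p q pq-open (p-ok , proj₁ (shared-∈₂ p~q)) (q-ok , proj₂ (shared-∈₂ p~q))

    traversals-W : ∀ γ → All (λ pq → Open G λ' (proj₁ pq) (proj₂ pq)) (cyclicPairs γ) →
                   traversals G x (W G γ) ≡ occurrences G P₁ Q₁ γ + occurrences G P₂ Q₂ γ
    traversals-W γ opens = begin
      length (filter (_≟ x) (map sharedEdge (cyclicPairs γ)))
        ≡⟨ cong length (filter-map (_≟ x) sharedEdge (cyclicPairs γ)) ⟩
      length (map sharedEdge (filter through-x? (cyclicPairs γ)))
        ≡⟨ length-map sharedEdge (filter through-x? (cyclicPairs γ)) ⟩
      length (filter through-x? (cyclicPairs γ))
        ≡⟨ length-filter-⊎ through-x? (traverses? P₁ Q₁) (traverses? P₂ Q₂)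
             (Traverses-shared open₁ P₁∈ Q₁∈) (Traverses-shared open₂ P₂∈ Q₂∈) Traverses-disjoint
             (cyclicPairs γ) (All.map open-step-through-x opens) ⟩
      occurrences G P₁ Q₁ γ + occurrences G P₂ Q₂ γ
        ∎
      where
      open ≡-Reasoning
      through-x? : Decidable (λ pq → sharedEdge pq ≡ x)
      through-x? pq = sharedEdge pq ≟ x

    Σtraversals≡2 : ∀ {Γ} → IsCycleSet G λ' Γ → sum (map (λ γ → traversals G x (W G γ)) Γ) ≡ 2
    Σtraversals≡2 {Γ} (cycles , once) = begin
      sum (map (λ γ → traversals G x (W G γ)) Γ)
        ≡⟨ cong sum (map-cong-local (All.map (λ {γ} γ-cycle → traversals-W γ (proj₂ (proj₂ γ-cycle))) cycles)) ⟩
      sum (map (λ γ → occurrences G P₁ Q₁ γ + occurrences G P₂ Q₂ γ) Γ)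
        ≡⟨ sum-map-+ (occurrences G P₁ Q₁) (occurrences G P₂ Q₂) Γ ⟩
      sum (map (occurrences G P₁ Q₁) Γ) + sum (map (occurrences G P₂ Q₂) Γ)
        ≡⟨ cong₂ _+_ (once P₁ Q₁ open₁) (once P₂ Q₂ open₂) ⟩
      2 ∎
      where open ≡-Reasoning

  module _ (λ' : Labeling G) (symmetric : SymmetricLabeling G λ') (valid : Valid G λ') where

    closed⇒¬Open : ∀ {p q} → λ' p q ≡ false → ¬ Open G λ' p q
    closed⇒¬Open closed (_ , opened) with () ← trans (sym opened) closed

    closed⇒¬Openʳ : ∀ {p q} → λ' p q ≡ false → ¬ Open G λ' q p
    closed⇒¬Openʳ closed q→p@(q~p , _) = closed⇒¬Open (trans (symmetric _ _ q~p) closed) q→p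

    Square-valid-A : ∀ {x} (sq : Square x) → let open Square sq in
                     E2Adj G A C × E2Adj G A D × λ' A C ≡ not (λ' A D)
    Square-valid-A {x} sq with valid x (Square.A sq) (Square.A∈ sq)
    ... | w , u , w∈ , u∈ , w≢A , u≢A , A~w , A~u , λw≡¬λu
      with Square-neighbours-A sq w w∈ w≢A A~w | Square-neighbours-A sq u u∈ u≢A A~u
    ... | inj₁ refl | inj₁ refl = ⊥-elim (not-¬ refl λw≡¬λu)
    ... | inj₁ refl | inj₂ refl = A~w , A~u , λw≡¬λu
    ... | inj₂ refl | inj₁ refl = A~u , A~w , not-flip λw≡¬λu
    ... | inj₂ refl | inj₂ refl = ⊥-elim (not-¬ refl λw≡¬λu)

    -- Validity at A, B and C makes the labels alternate around A C B D.
    Square-AC-open⇒OpenMatching : ∀ {x} (sq : Square x) → λ' (Square.A sq) (Square.C sq) ≡ true →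
                                  OpenMatching λ' x
    Square-AC-open⇒OpenMatching {x} sq λAC = record
      { P₁ = A ; Q₁ = C ; P₂ = B ; Q₂ = D ; P₁∈ = A∈ ; Q₁∈ = C∈ ; P₂∈ = B∈ ; Q₂∈ = D∈
      ; open₁ = A~C , λAC ; open₂ = B~D , λBD
      ; P₁≢P₂ = A≢B ; P₁≢Q₂ = λ { refl → E2Adj-irrefl A~D } ; Q₁≢P₂ = λ { refl → E2Adj-irrefl C~B } ; Q₁≢Q₂ = C≢D
      ; only = only }
      where
      open Square sq
      A-valid = Square-valid-A sq
      B-valid = Square-valid-A (Square-swapAB sq)
      C-valid = Square-valid-A (Square-swapSides sq)
      A~C = proj₁ A-valid
      A~D = proj₁ (proj₂ A-valid)
      B~D = proj₁ (proj₂ B-valid)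
      C~B = proj₁ (proj₂ C-valid)

      λAD : λ' A D ≡ false
      λAD = trans (not-flip (proj₂ (proj₂ A-valid))) (cong not λAC)
      λCB : λ' C B ≡ false
      λCB = trans (not-flip (proj₂ (proj₂ C-valid))) (cong not (trans (symmetric C A (E2Adj-sym A~C)) λAC))
      λBC : λ' B C ≡ false
      λBC = trans (symmetric B C (E2Adj-sym C~B)) λCB
      λBD : λ' B D ≡ true
      λBD = trans (not-flip (proj₂ (proj₂ B-valid))) (cong not λBC)

      only : ∀ p q → Open G λ' p q → InClique G x p → InClique G x q →
             Traverses A C (p , q) ⊎ Traverses B D (p , q)
      only p q pq-open@(p~q , _) p∈ q∈ with cover p p∈ | cover q q∈
      ... | inj₁ (inj₁ refl) | inj₁ (inj₁ refl) = ⊥-elim (E2Adj-irrefl p~q)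
      ... | inj₁ (inj₁ refl) | inj₁ (inj₂ refl) = ⊥-elim (A≁B p~q)
      ... | inj₁ (inj₁ refl) | inj₂ (inj₁ refl) = inj₁ (inj₁ refl)
      ... | inj₁ (inj₁ refl) | inj₂ (inj₂ refl) = ⊥-elim (closed⇒¬Open λAD pq-open)
      ... | inj₁ (inj₂ refl) | inj₁ (inj₁ refl) = ⊥-elim (A≁B (E2Adj-sym p~q))
      ... | inj₁ (inj₂ refl) | inj₁ (inj₂ refl) = ⊥-elim (E2Adj-irrefl p~q)
      ... | inj₁ (inj₂ refl) | inj₂ (inj₁ refl) = ⊥-elim (closed⇒¬Open λBC pq-open)
      ... | inj₁ (inj₂ refl) | inj₂ (inj₂ refl) = inj₂ (inj₁ refl)
      ... | inj₂ (inj₁ refl) | inj₁ (inj₁ refl) = inj₁ (inj₂ refl)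
      ... | inj₂ (inj₁ refl) | inj₁ (inj₂ refl) = ⊥-elim (closed⇒¬Openʳ λBC pq-open)
      ... | inj₂ (inj₁ refl) | inj₂ (inj₁ refl) = ⊥-elim (E2Adj-irrefl p~q)
      ... | inj₂ (inj₁ refl) | inj₂ (inj₂ refl) = ⊥-elim (C≁D p~q)
      ... | inj₂ (inj₂ refl) | inj₁ (inj₁ refl) = ⊥-elim (closed⇒¬Openʳ λAD pq-open)
      ... | inj₂ (inj₂ refl) | inj₁ (inj₂ refl) = inj₂ (inj₂ refl)
      ... | inj₂ (inj₂ refl) | inj₂ (inj₁ refl) = ⊥-elim (C≁D (E2Adj-sym p~q))
      ... | inj₂ (inj₂ refl) | inj₂ (inj₂ refl) = ⊥-elim (E2Adj-irrefl p~q)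

    Square⇒OpenMatching : ∀ {x} → Square x → OpenMatching λ' x
    Square⇒OpenMatching sq with λ' (Square.A sq) (Square.C sq) in λAC
    ... | true  = Square-AC-open⇒OpenMatching sq λAC
    ... | false = Square-AC-open⇒OpenMatching (Square-swapCD sq)
                    (trans (not-flip (proj₂ (proj₂ (Square-valid-A sq)))) (cong not λAC))

lemma2p9 : (G : Graph) → Simple G → Connected G → Bridgeless G →
           TriangleFree G → Cubic G →
           (λ' : Labeling G) → SymmetricLabeling G λ' → Valid G λ' →
           (Γ : List (List (Pair G))) → IsCycleSet G λ' Γ →
           ((γ : List (Pair G)) → γ ∈ Γ → ClosedWalk G (W G γ)) ×
           ((e : Fin (Graph.m G)) → sum (map (λ γ → traversals G e (W G γ)) Γ) ≡ 2)
lemma2p9 G simple _ _ _ cubic λ' symmetric valid Γ Γ-cycles@(cycles , _) =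
  (λ γ γ∈Γ → W-closedWalk G simple γ (All.map proj₁ (proj₂ (proj₂ (All.lookup cycles γ∈Γ))))) ,
  (λ e → Σtraversals≡2 G (Square⇒OpenMatching G λ' symmetric valid (reducedClique-square G simple cubic e))
                          Γ-cycles)
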